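{- Let $I$ be an instance and $v$ a variety. A solid of variety $v$ is composable from $I$ if and only if the bipartite graph $B_v$ has a matching of size $8$.
   Context: Fix a palette of six distinct colors, totally ordered. A (colored) cube is a unit cube each of whose six faces is painted with exactly one color of the palette, all six faces receiving different colors. Two colored cubes have the same variety if one can be rotated onto the other (30 varieties). An instance is a finite multiset of colored cubes. A solid is a $2\times2\times2$ cube assembled from eight colored unit cubes such that each of its six outer $2\times2$ faces is of a single color and the six outer faces have six different colors; its variety is defined as for unit cubes. A solid of variety $v$ is composable from $I$ if some eight cubes of $I$ can be placed and oriented to form a solid of variety $v$. For a corner of a cube, its corner triple is the ordered triple of the three colors of the faces meeting at that corner, listed in clockwise order around the corner and cyclically rotated so that the smallest color comes first; $T_v$ denotes the set of eight corner triples of variety $v$. $B_v$ is the bipartite graph whose nodes on one side are the cubes of $I$ (each copy of a repeated variety being a distinct node) and on the other side the elements of $T_v$, where a cube $c$ and $\tau\in T_v$ are joined by an edge iff $\tau$ is a corner triple of $c$'s variety. -}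

module Defs where

open import Data.Bool using (Bool; true; false; _xor_; not; _∧_; if_then_else_)
open import Data.Fin using (Fin; _<?_)
open import Data.Nat using (ℕ)
open import Data.Product using (_×_; _,_; Σ; ∃; ∃-syntax; proj₁)
open import Data.List using (List; length; lookup)
open import Relation.Nullary using (does)
open import Relation.Binary.PropositionalEquality using (_≡_)
open import Function.Definitions using (Injective)

Color : Set
Color = Fin 6

-- Geometry of a cube centred at the origin.
-- A face is (axis , s): its outward normal is +e_axis if s = true,
-- and -e_axis if s = false.

data Axis : Set where
  X Y Z : Axis

Face : Set
Face = Axis × Bool

Coloring : Set
Coloring = Face → Color

Cube : Set
Cube = Σ Coloring (Injective _≡_ _≡_)

col : Cube → Coloring
col = proj₁

-- Rotations of the cube: signed permutation matrices of determinant +1.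

data AxisPerm : Set where
  idP swXY swXZ swYZ cycXYZ cycXZY : AxisPerm

applyP : AxisPerm → Axis → Axis
applyP idP    a = a
applyP swXY   X = Y
applyP swXY   Y = X
applyP swXY   Z = Z
applyP swXZ   X = Z
applyP swXZ   Y = Y
applyP swXZ   Z = X
applyP swYZ   X = X
applyP swYZ   Y = Z
applyP swYZ   Z = Y
applyP cycXYZ X = Y
applyP cycXYZ Y = Z
applyP cycXYZ Z = X
applyP cycXZY X = Z
applyP cycXZY Z = Y
applyP cycXZY Y = X

oddP : AxisPerm → Bool
oddP idP    = false
oddP swXY   = true
oddP swXZ   = true
oddP swYZ   = true
oddP cycXYZ = false
oddP cycXZY = false

-- The linear map e_a ↦ (flip a ? -1 : +1) e_(perm a).
-- Its determinant is sgn(perm) · Π (±1), which is +1 iff the parity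
-- of perm equals the parity of the number of flipped axes.
record Rotation : Set where
  field
    perm   : AxisPerm
    flip   : Axis → Bool
    proper : oddP perm ≡ (flip X xor (flip Y xor flip Z))

open Rotation public

rotFace : Rotation → Face → Face
rotFace R (a , s) = applyP (perm R) a , (s xor flip R a)

SameVariety : Coloring → Coloring → Set
SameVariety c d = ∃[ R ] (∀ f → d f ≡ c (rotFace R f))

-- Corners and corner triples.
-- A corner is (sx , sy , sz); it is the meeting point of the faces
-- (X , sx), (Y , sy), (Z , sz).

Corner : Set
Corner = Bool × Bool × Bool

Triple : Set
Triple = Color × Color × Color

-- Colors of the three faces at a corner in CLOCKWISE order as seen from
-- outside the cube.  At the corner (+,+,+) the normals e_x, e_y, e_z
-- appear counterclockwise from outside, so clockwise is x, z, y; each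
-- negative sign reverses the orientation.
clockwiseColors : Coloring → Corner → Triple
clockwiseColors c (sx , sy , sz) =
  if (not sx xor (not sy xor not sz))
  then (c (X , sx) , c (Y , sy) , c (Z , sz))
  else (c (X , sx) , c (Z , sz) , c (Y , sy))

normalizeTriple : Triple → Triple
normalizeTriple (a , b , c) =
  if does (a <? b) ∧ does (a <? c) then (a , b , c)
  else (if does (b <? c) then (b , c , a) else (c , a , b))

cornerTriple : Coloring → Corner → Triple
cornerTriple c k = normalizeTriple (clockwiseColors c k)

IsCornerTriple : Coloring → Triple → Set
IsCornerTriple c τ = ∃[ k ] cornerTriple c k ≡ τ

InT : Cube → Triple → Set
InT v τ = IsCornerTriple (col v) τ

-- Instances: finite multisets of cubes, represented as lists; the
-- nodes of one side of B_v are the positions Fin (length I).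

Instance : Set
Instance = List Cube

BEdge : (I : Instance) → Cube → Fin (length I) → Triple → Set
BEdge I v i τ = InT v τ × IsCornerTriple (col (lookup I i)) τ

record Matching (I : Instance) (v : Cube) (k : ℕ) : Set where
  field
    cubeNode   : Fin k → Fin (length I)
    tripleNode : Fin k → Triple
    isEdge     : ∀ j → BEdge I v (cubeNode j) (tripleNode j)
    cubeDisj   : Injective _≡_ _≡_ cubeNode
    tripleDisj : Injective _≡_ _≡_ tripleNode

-- The 2×2×2 cube is centred at the origin; the unit cube at
-- position p = (bx , by , bz) lies on the positive side of axis a iff the
-- a-component of p is true.  Its face (a , component a of p) lies on the
-- outer face (a , component a of p) of the solid; these are exactly the
-- outer faces of the unit cubes.

Position : Set
Position = Bool × Bool × Bool

component : Position → Axis → Bool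
component (bx , by , bz) X = bx
component (bx , by , bz) Y = by
component (bx , by , bz) Z = bz

record Solid : Set where
  field
    -- the (already oriented) unit cube at each of the eight positions
    unit       : Position → Cube
    outerColor : Coloring
    monochrome : ∀ p a → col (unit p) (a , component p a) ≡ outerColor (a , component p a)
    outerDistinct : Injective _≡_ _≡_ outerColor

open Solid public

SolidOfVariety : Solid → Cube → Set
SolidOfVariety S v = SameVariety (col v) (outerColor S)

Composable : Instance → Cube → Set
Composable I v =
  ∃[ S ] ∃[ which ]
    ( Injective _≡_ _≡_ which
    × (∀ p → SameVariety (col (lookup I (which p))) (col (unit S p)))
    × SolidOfVariety S v )

-- A cube c can sit at the corner p of a solid of variety v exactly when one of the corner
-- triples of c is the corner triple of v at p: a corner triple determines the three colors
-- at a corner up to cyclic order, and since rotations act transitively on corners together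
-- with a cyclic alignment of their three faces, c can be turned so that those colors face
-- outwards at p. The eight corners of v carry eight distinct triples, so assembling a solid
-- amounts to choosing distinct cubes for the eight triples of T_v, i.e. a matching of size 8.
-- The purely geometric facts about the 24 rotations and 8 corners are checked exhaustively.
module Submission where

open import Data.Bool using (Bool; true; false; _xor_; not; _∧_; if_then_else_)
open import Data.Bool.Properties using (xor-assoc; xor-same; xor-identityʳ)
  renaming (_≟_ to _≟ᴮ_)
open import Data.Fin using (Fin; zero; suc; _<?_; punchOut)
open import Data.Fin.Properties using (pigeonhole; punchOut-injective; <⇒≢)
  renaming (_≟_ to _≟ᶠ_; any? to anyFin?; all? to allFin?)
open import Data.List using (List; []; _∷_; length; lookup; allFin; cartesianProduct)
open import Data.List.Membership.Propositional using (_∈_; lose)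
open import Data.List.Membership.Propositional.Properties using (∈-allFin; ∈-cartesianProduct⁺)
import Data.List.Relation.Unary.All as All
open import Data.List.Relation.Unary.Any as Any using (here; there)
open import Data.List.Relation.Unary.Any.Properties using (lookup-index)
import Data.Nat as ℕ
open import Data.Nat.Properties using (n<1+n)
open import Data.Product using (_×_; _,_; ∃; ∃₂; proj₁; proj₂)
open import Data.Product.Properties using (≡-dec)
open import Function.Base using (_∘_)
open import Function.Bundles using (_⇔_; mk⇔)
open import Function.Definitions using (Injective)
open import Relation.Binary.Definitions using (DecidableEquality)
open import Relation.Binary.PropositionalEquality
  using (_≡_; _≢_; refl; sym; trans; cong; cong₂; module ≡-Reasoning)
open import Relation.Nullary using (Dec; yes; no; does; contradiction)
open import Relation.Nullary.Decidable using (from-yes; map′; _×-dec_; _→-dec_; ¬?)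

open import Defs

open ≡-Reasoning

record Enumeration (A : Set) : Set where
  field
    elements : List A
    complete : ∀ x → x ∈ elements

open Enumeration

module _ {A : Set} (E : Enumeration A) where

  ∀? : {P : A → Set} → (∀ x → Dec (P x)) → Dec (∀ x → P x)
  ∀? P? = map′ (λ ps x → All.lookup ps (complete E x)) (λ ps → All.tabulate λ {x} _ → ps x)
               (All.all? P? (elements E))

  ∃? : {P : A → Set} → (∀ x → Dec (P x)) → Dec (∃ P)
  ∃? P? = map′ Any.satisfied (λ (x , px) → lose (complete E x) px) (Any.any? P? (elements E))

enumFin : ∀ n → Enumeration (Fin n)
enumFin n = record { elements = allFin n ; complete = ∈-allFin }

enum× : {A B : Set} → Enumeration A → Enumeration B → Enumeration (A × B)
enum× E F = record
  { elements = cartesianProduct (elements E) (elements F)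
  ; complete = λ (x , y) → ∈-cartesianProduct⁺ (complete E x) (complete F y) }

enumBool : Enumeration Bool
enumBool = record
  { elements = true ∷ false ∷ []
  ; complete = λ { true → here refl ; false → there (here refl) } }

enumAxis : Enumeration Axis
enumAxis = record
  { elements = X ∷ Y ∷ Z ∷ []
  ; complete = λ { X → here refl ; Y → there (here refl) ; Z → there (there (here refl)) } }

enumAxisPerm : Enumeration AxisPerm
enumAxisPerm = record
  { elements = idP ∷ swXY ∷ swXZ ∷ swYZ ∷ cycXYZ ∷ cycXZY ∷ []
  ; complete = λ
      { idP → here refl
      ; swXY → there (here refl)
      ; swXZ → there (there (here refl))
      ; swYZ → there (there (there (here refl)))
      ; cycXYZ → there (there (there (there (here refl))))
      ; cycXZY → there (there (there (there (there (here refl))))) } }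

enumBool³ : Enumeration (Bool × Bool × Bool)
enumBool³ = enum× enumBool (enum× enumBool enumBool)

enumColor³ : Enumeration Triple
enumColor³ = enum× (enumFin 6) (enum× (enumFin 6) (enumFin 6))

_≟ᴬ_ : DecidableEquality Axis
X ≟ᴬ X = yes refl
Y ≟ᴬ Y = yes refl
Z ≟ᴬ Z = yes refl
X ≟ᴬ Y = no λ ()
X ≟ᴬ Z = no λ ()
Y ≟ᴬ X = no λ ()
Y ≟ᴬ Z = no λ ()
Z ≟ᴬ X = no λ ()
Z ≟ᴬ Y = no λ ()

_≟ᶠᵃᶜᵉ_ : DecidableEquality Face
_≟ᶠᵃᶜᵉ_ = ≡-dec _≟ᴬ_ _≟ᴮ_

_≟ᶜ_ : DecidableEquality Corner
_≟ᶜ_ = ≡-dec _≟ᴮ_ (≡-dec _≟ᴮ_ _≟ᴮ_)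

_≟ᶠ³_ : DecidableEquality (Face × Face × Face)
_≟ᶠ³_ = ≡-dec _≟ᶠᵃᶜᵉ_ (≡-dec _≟ᶠᵃᶜᵉ_ _≟ᶠᵃᶜᵉ_)

_≟ᵀ_ : DecidableEquality Triple
_≟ᵀ_ = ≡-dec _≟ᶠ_ (≡-dec _≟ᶠ_ _≟ᶠ_)

map₃ : {A B : Set} → (A → B) → A × A × A → B × B × B
map₃ f (x , y , z) = f x , f y , f z

rotate : {A : Set} → Fin 3 → A × A × A → A × A × A
rotate zero t = t
rotate (suc zero) (x , y , z) = y , z , x
rotate (suc (suc zero)) (x , y , z) = z , x , y

Distinct₃ : {A : Set} → A × A × A → Set
Distinct₃ (x , y , z) = x ≢ y × y ≢ z × z ≢ x

module _ {A B : Set} where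

  rotate-map₃ : (f : A → B) (m : Fin 3) (t : A × A × A) →
                rotate m (map₃ f t) ≡ map₃ f (rotate m t)
  rotate-map₃ f zero t = refl
  rotate-map₃ f (suc zero) t = refl
  rotate-map₃ f (suc (suc zero)) t = refl

  map₃-cong : {f g : A → B} → (∀ x → f x ≡ g x) → ∀ t → map₃ f t ≡ map₃ g t
  map₃-cong f≗g (x , y , z) = cong₂ _,_ (f≗g x) (cong₂ _,_ (f≗g y) (f≗g z))

  map₃-injective : {f : A → B} → Injective _≡_ _≡_ f → Injective _≡_ _≡_ (map₃ f)
  map₃-injective f-inj eq =
    cong₂ _,_ (f-inj (cong proj₁ eq))
              (cong₂ _,_ (f-inj (cong (proj₁ ∘ proj₂) eq)) (f-inj (cong (proj₂ ∘ proj₂) eq)))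

  map₃-distinct : {f : A → B} → Injective _≡_ _≡_ f →
                  ∀ {t} → Distinct₃ t → Distinct₃ (map₃ f t)
  map₃-distinct f-inj (x≢y , y≢z , z≢x) = x≢y ∘ f-inj , y≢z ∘ f-inj , z≢x ∘ f-inj

rotate-≡-rotate : {A : Set} (a b : Fin 3) (t u : A × A × A) → rotate a t ≡ rotate b u →
                  ∃ λ m → u ≡ rotate m t
rotate-≡-rotate zero zero t u refl = zero , refl
rotate-≡-rotate zero (suc zero) t u refl = suc (suc zero) , refl
rotate-≡-rotate zero (suc (suc zero)) t u refl = suc zero , refl
rotate-≡-rotate (suc zero) zero t u refl = suc zero , refl
rotate-≡-rotate (suc zero) (suc zero) t u refl = zero , refl
rotate-≡-rotate (suc zero) (suc (suc zero)) t u refl = suc (suc zero) , refl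
rotate-≡-rotate (suc (suc zero)) zero t u refl = suc (suc zero) , refl
rotate-≡-rotate (suc (suc zero)) (suc zero) t u refl = suc zero , refl
rotate-≡-rotate (suc (suc zero)) (suc (suc zero)) t u refl = zero , refl

normalizeTriple-rotation : ∀ t → ∃ λ m → normalizeTriple t ≡ rotate m t
normalizeTriple-rotation (a , b , c) with does (a <? b) ∧ does (a <? c)
... | true = zero , refl
... | false with does (b <? c)
...   | true = suc zero , refl
...   | false = suc (suc zero) , refl

distinct₃? : (t : Triple) → Dec (Distinct₃ t)
distinct₃? (a , b , c) = ¬? (a ≟ᶠ b) ×-dec (¬? (b ≟ᶠ c) ×-dec ¬? (c ≟ᶠ a))

normalizeTriple-rotate₁? : ∀ t →
  Dec (Distinct₃ t → normalizeTriple (rotate (suc zero) t) ≡ normalizeTriple t)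
normalizeTriple-rotate₁? t =
  distinct₃? t →-dec (normalizeTriple (rotate (suc zero) t) ≟ᵀ normalizeTriple t)

abstract
  normalizeTriple-rotate₁ : ∀ t → Distinct₃ t →
                            normalizeTriple (rotate (suc zero) t) ≡ normalizeTriple t
  normalizeTriple-rotate₁ = from-yes (∀? enumColor³ normalizeTriple-rotate₁?)

normalizeTriple-rotate : ∀ m t → Distinct₃ t → normalizeTriple (rotate m t) ≡ normalizeTriple t
normalizeTriple-rotate zero t _ = refl
normalizeTriple-rotate (suc zero) t t-distinct = normalizeTriple-rotate₁ t t-distinct
normalizeTriple-rotate (suc (suc zero)) (x , y , z) (x≢y , y≢z , z≢x) =
  sym (normalizeTriple-rotate₁ (z , x , y) (z≢x , x≢y , y≢z))

frame : Corner → Face × Face × Face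
frame (sx , sy , sz) =
  if (not sx xor (not sy xor not sz))
  then ((X , sx) , (Y , sy) , (Z , sz))
  else ((X , sx) , (Z , sz) , (Y , sy))

clockwiseColors-frame : ∀ c k → clockwiseColors c k ≡ map₃ c (frame k)
clockwiseColors-frame c (sx , sy , sz) with not sx xor (not sy xor not sz)
... | true = refl
... | false = refl

frame-distinct : ∀ k → Distinct₃ (frame k)
frame-distinct (sx , sy , sz) with not sx xor (not sy xor not sz)
... | true = (λ ()) , (λ ()) , (λ ())
... | false = (λ ()) , (λ ()) , (λ ())

AgreeAt : Coloring → Coloring → Corner → Set
AgreeAt c d p = ∀ a → c (a , component p a) ≡ d (a , component p a)

agreeAt⇒map₃-frame : ∀ c d p → AgreeAt c d p → map₃ c (frame p) ≡ map₃ d (frame p)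
agreeAt⇒map₃-frame c d (sx , sy , sz) c≗d with not sx xor (not sy xor not sz)
... | true = cong₂ _,_ (c≗d X) (cong₂ _,_ (c≗d Y) (c≗d Z))
... | false = cong₂ _,_ (c≗d X) (cong₂ _,_ (c≗d Z) (c≗d Y))

map₃-frame⇒agreeAt : ∀ c d p → map₃ c (frame p) ≡ map₃ d (frame p) → AgreeAt c d p
map₃-frame⇒agreeAt c d (sx , sy , sz) eq a with not sx xor (not sy xor not sz)
map₃-frame⇒agreeAt c d (sx , sy , sz) eq X | true = cong proj₁ eq
map₃-frame⇒agreeAt c d (sx , sy , sz) eq Y | true = cong (proj₁ ∘ proj₂) eq
map₃-frame⇒agreeAt c d (sx , sy , sz) eq Z | true = cong (proj₂ ∘ proj₂) eq
map₃-frame⇒agreeAt c d (sx , sy , sz) eq X | false = cong proj₁ eq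
map₃-frame⇒agreeAt c d (sx , sy , sz) eq Y | false = cong (proj₂ ∘ proj₂) eq
map₃-frame⇒agreeAt c d (sx , sy , sz) eq Z | false = cong (proj₁ ∘ proj₂) eq

rotate-frame-injective? : ∀ k k' a b → Dec (rotate a (frame k) ≡ rotate b (frame k') → k ≡ k')
rotate-frame-injective? k k' a b = (rotate a (frame k) ≟ᶠ³ rotate b (frame k')) →-dec (k ≟ᶜ k')

abstract
  rotate-frame-injective : ∀ k k' a b → rotate a (frame k) ≡ rotate b (frame k') → k ≡ k'
  rotate-frame-injective = from-yes (∀? enumBool³ λ k → ∀? enumBool³ λ k' →
    ∀? (enumFin 3) λ a → ∀? (enumFin 3) λ b → rotate-frame-injective? k k' a b)

signedPerm : AxisPerm → (Axis → Bool) → Face → Face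
signedPerm P φ (a , s) = applyP P a , (s xor φ a)

-- Sign vectors as triples rather than functions Axis → Bool, so that they can be enumerated.
flips : Bool × Bool × Bool → Axis → Bool
flips (x , y , z) X = x
flips (x , y , z) Y = y
flips (x , y , z) Z = z

Proper : AxisPerm → Bool × Bool × Bool → Set
Proper P σ = oddP P ≡ (flips σ X xor (flips σ Y xor flips σ Z))

proper? : ∀ P σ → Dec (Proper P σ)
proper? P σ = oddP P ≟ᴮ (flips σ X xor (flips σ Y xor flips σ Z))

rotation : ∀ P σ → Proper P σ → Rotation
rotation P σ P-proper = record { perm = P ; flip = flips σ ; proper = P-proper }

signedPerm-flips : ∀ P φ f → signedPerm P φ f ≡ signedPerm P (flips (φ X , φ Y , φ Z)) f
signedPerm-flips P φ (X , s) = refl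
signedPerm-flips P φ (Y , s) = refl
signedPerm-flips P φ (Z , s) = refl

-- Properness is what makes a signed permutation preserve the clockwise orientation.
signedPerm-frame? : ∀ P σ p → Dec (Proper P σ →
  ∃₂ λ k m → map₃ (signedPerm P (flips σ)) (frame p) ≡ rotate m (frame k))
signedPerm-frame? P σ p = proper? P σ →-dec (∃? enumBool³ λ k → ∃? (enumFin 3) λ m →
  map₃ (signedPerm P (flips σ)) (frame p) ≟ᶠ³ rotate m (frame k))

abstract
  signedPerm-frame : ∀ P σ p → Proper P σ →
    ∃₂ λ k m → map₃ (signedPerm P (flips σ)) (frame p) ≡ rotate m (frame k)
  signedPerm-frame = from-yes (∀? enumAxisPerm λ P → ∀? enumBool³ λ σ → ∀? enumBool³ λ p →
    signedPerm-frame? P σ p)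

rotFace-frame : ∀ R p → ∃₂ λ k m → map₃ (rotFace R) (frame p) ≡ rotate m (frame k)
rotFace-frame R p with signedPerm-frame (perm R) (flip R X , flip R Y , flip R Z) p (proper R)
... | k , m , eq = k , m , trans (map₃-cong (signedPerm-flips (perm R) (flip R)) (frame p)) eq

frame-transitive? : ∀ p k m → Dec (∃₂ λ P σ →
  Proper P σ × map₃ (signedPerm P (flips σ)) (frame p) ≡ rotate m (frame k))
frame-transitive? p k m = ∃? enumAxisPerm λ P → ∃? enumBool³ λ σ →
  proper? P σ ×-dec (map₃ (signedPerm P (flips σ)) (frame p) ≟ᶠ³ rotate m (frame k))

abstract
  frame-transitive-signedPerm : ∀ p k m → ∃₂ λ P σ →
    Proper P σ × map₃ (signedPerm P (flips σ)) (frame p) ≡ rotate m (frame k)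
  frame-transitive-signedPerm = from-yes (∀? enumBool³ λ p → ∀? enumBool³ λ k →
    ∀? (enumFin 3) λ m → frame-transitive? p k m)

frame-transitive : ∀ p k m → ∃ λ R → map₃ (rotFace R) (frame p) ≡ rotate m (frame k)
frame-transitive p k m with frame-transitive-signedPerm p k m
... | P , σ , P-proper , eq = rotation P σ P-proper , eq

applyP-injective? : ∀ P a b → Dec (applyP P a ≡ applyP P b → a ≡ b)
applyP-injective? P a b = (applyP P a ≟ᴬ applyP P b) →-dec (a ≟ᴬ b)

abstract
  applyP-injective : ∀ P a b → applyP P a ≡ applyP P b → a ≡ b
  applyP-injective = from-yes (∀? enumAxisPerm λ P → ∀? enumAxis λ a → ∀? enumAxis λ b →
    applyP-injective? P a b)

xor-cancelʳ : ∀ x {s t} → s xor x ≡ t xor x → s ≡ t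
xor-cancelʳ x {s} {t} eq = trans (sym (xor-xor x s)) (trans (cong (_xor x) eq) (xor-xor x t))
  where
  xor-xor : ∀ x s → (s xor x) xor x ≡ s
  xor-xor x s = trans (xor-assoc s x x) (trans (cong (s xor_) (xor-same x)) (xor-identityʳ s))

rotFace-injective : ∀ R → Injective _≡_ _≡_ (rotFace R)
rotFace-injective R {a , s} {b , t} eq with applyP-injective (perm R) a b (cong proj₁ eq)
... | refl = cong (a ,_) (xor-cancelʳ (flip R a) (cong proj₂ eq))

cornerTriple-frame : ∀ c k → cornerTriple c k ≡ normalizeTriple (map₃ c (frame k))
cornerTriple-frame c k = cong normalizeTriple (clockwiseColors-frame c k)

cornerTriple-rotation : ∀ c k → ∃ λ m → cornerTriple c k ≡ map₃ c (rotate m (frame k))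
cornerTriple-rotation c k with normalizeTriple-rotation (map₃ c (frame k))
... | m , eq = m , trans (cornerTriple-frame c k) (trans eq (rotate-map₃ c m (frame k)))

normalizeTriple-rotate-frame : ∀ {c} → Injective _≡_ _≡_ c → ∀ m k →
  normalizeTriple (map₃ c (rotate m (frame k))) ≡ cornerTriple c k
normalizeTriple-rotate-frame {c} c-inj m k = begin
  normalizeTriple (map₃ c (rotate m (frame k)))
    ≡⟨ cong normalizeTriple (rotate-map₃ c m (frame k)) ⟨
  normalizeTriple (rotate m (map₃ c (frame k)))
    ≡⟨ normalizeTriple-rotate m _ (map₃-distinct c-inj (frame-distinct k)) ⟩
  normalizeTriple (map₃ c (frame k))
    ≡⟨ cornerTriple-frame c k ⟨
  cornerTriple c k
    ∎

cornerTriple-injective : ∀ {c} → Injective _≡_ _≡_ c → Injective _≡_ _≡_ (cornerTriple c)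
cornerTriple-injective {c} c-inj {k} {k'} eq with cornerTriple-rotation c k | cornerTriple-rotation c k'
... | a , k-rot | b , k'-rot =
  rotate-frame-injective k k' a b (map₃-injective c-inj (trans (sym k-rot) (trans eq k'-rot)))

cornerTriple-local : ∀ c d p → AgreeAt c d p → cornerTriple c p ≡ cornerTriple d p
cornerTriple-local c d p c≗d = begin
  cornerTriple c p                    ≡⟨ cornerTriple-frame c p ⟩
  normalizeTriple (map₃ c (frame p))  ≡⟨ cong normalizeTriple (agreeAt⇒map₃-frame c d p c≗d) ⟩
  normalizeTriple (map₃ d (frame p))  ≡⟨ cornerTriple-frame d p ⟨
  cornerTriple d p                    ∎

cornerTriple-rotFace : ∀ {c} → Injective _≡_ _≡_ c → ∀ R p →
  ∃ λ k → cornerTriple (c ∘ rotFace R) p ≡ cornerTriple c k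
cornerTriple-rotFace {c} c-inj R p with rotFace-frame R p
... | k , m , eq = k , (begin
  cornerTriple (c ∘ rotFace R) p                         ≡⟨ cornerTriple-frame (c ∘ rotFace R) p ⟩
  normalizeTriple (map₃ c (map₃ (rotFace R) (frame p)))  ≡⟨ cong (normalizeTriple ∘ map₃ c) eq ⟩
  normalizeTriple (map₃ c (rotate m (frame k)))          ≡⟨ normalizeTriple-rotate-frame c-inj m k ⟩
  cornerTriple c k                                       ∎)

cornerTriple-align : ∀ c d k p → cornerTriple c k ≡ cornerTriple d p →
  ∃ λ R → AgreeAt (c ∘ rotFace R) d p
cornerTriple-align c d k p eq with cornerTriple-rotation c k | cornerTriple-rotation d p
... | a , k-rot | b , p-rot
  with rotate-≡-rotate a b (map₃ c (frame k)) (map₃ d (frame p))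
  (begin
    rotate a (map₃ c (frame k))  ≡⟨ rotate-map₃ c a (frame k) ⟩
    map₃ c (rotate a (frame k))  ≡⟨ k-rot ⟨
    cornerTriple c k             ≡⟨ eq ⟩
    cornerTriple d p             ≡⟨ p-rot ⟩
    map₃ d (rotate b (frame p))  ≡⟨ rotate-map₃ d b (frame p) ⟨
    rotate b (map₃ d (frame p))  ∎)
... | m , eqₘ with frame-transitive p k m
... | R , eqᵣ = R , map₃-frame⇒agreeAt (c ∘ rotFace R) d p (begin
  map₃ c (map₃ (rotFace R) (frame p))  ≡⟨ cong (map₃ c) eqᵣ ⟩
  map₃ c (rotate m (frame k))          ≡⟨ rotate-map₃ c m (frame k) ⟨
  rotate m (map₃ c (frame k))          ≡⟨ eqₘ ⟨
  map₃ d (frame p)                     ∎)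

sameVariety-cornerTriple : ∀ {c d} → Injective _≡_ _≡_ c → SameVariety c d →
  ∀ p → IsCornerTriple c (cornerTriple d p)
sameVariety-cornerTriple {c} {d} c-inj (R , d≗cR) p with cornerTriple-rotFace c-inj R p
... | k , eq = k , sym (trans (cornerTriple-local d (c ∘ rotFace R) p (λ a → d≗cR _)) eq)

Fin-injective⇒surjective : ∀ {n} (f : Fin n → Fin n) → Injective _≡_ _≡_ f →
                           ∀ y → ∃ λ x → f x ≡ y
Fin-injective⇒surjective {ℕ.suc n} f f-inj y with anyFin? (λ x → f x ≟ᶠ y)
... | yes hit = hit
... | no miss with pigeonhole (n<1+n n) (λ x → punchOut (miss ∘ (x ,_) ∘ sym))
... | i , j , i<j , eq =
  contradiction (f-inj (punchOut-injective {i = y} (miss ∘ (i ,_) ∘ sym) (miss ∘ (j ,_) ∘ sym) eq))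
                (<⇒≢ i<j)

cornerIndex : Corner → Fin 8
cornerIndex k = Any.index (complete enumBool³ k)

cornerAt : Fin 8 → Corner
cornerAt = lookup (elements enumBool³)

cornerAt-cornerIndex : ∀ k → cornerAt (cornerIndex k) ≡ k
cornerAt-cornerIndex k = sym (lookup-index (complete enumBool³ k))

cornerIndex-cornerAt : ∀ j → cornerIndex (cornerAt j) ≡ j
cornerIndex-cornerAt = from-yes (allFin? λ j → cornerIndex (cornerAt j) ≟ᶠ j)

cornerAt-injective : Injective _≡_ _≡_ cornerAt
cornerAt-injective {i} {j} eq =
  trans (sym (cornerIndex-cornerAt i)) (trans (cong cornerIndex eq) (cornerIndex-cornerAt j))

cornerIndex-injective : Injective _≡_ _≡_ cornerIndex
cornerIndex-injective {k} {k'} eq =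
  trans (sym (cornerAt-cornerIndex k)) (trans (cong cornerAt eq) (cornerAt-cornerIndex k'))

corner-injective⇒surjective : (κ : Fin 8 → Corner) → Injective _≡_ _≡_ κ →
                              ∀ p → ∃ λ j → κ j ≡ p
corner-injective⇒surjective κ κ-inj p
  with Fin-injective⇒surjective (cornerIndex ∘ κ) (κ-inj ∘ cornerIndex-injective) (cornerIndex p)
... | j , eq = j , cornerIndex-injective eq

rotateCube : Rotation → Cube → Cube
rotateCube R (c , c-inj) = c ∘ rotFace R , rotFace-injective R ∘ c-inj

sameVariety-refl : ∀ c → SameVariety c c
sameVariety-refl c = identity , λ { (a , true) → refl ; (a , false) → refl }
  where
  identity : Rotation
  identity = record { perm = idP ; flip = λ _ → false ; proper = refl }

composable⇒matching : ∀ I v → Composable I v → Matching I v 8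
composable⇒matching I v (S , which , which-inj , unit-variety , S-variety) = record
  { cubeNode = which ∘ cornerAt
  ; tripleNode = cornerTriple (outerColor S) ∘ cornerAt
  ; isEdge = λ j → sameVariety-cornerTriple (proj₂ v) S-variety (cornerAt j) , cubeEdge (cornerAt j)
  ; cubeDisj = cornerAt-injective ∘ which-inj
  ; tripleDisj = cornerAt-injective ∘ cornerTriple-injective (outerDistinct S) }
  where
  cubeEdge : ∀ p → IsCornerTriple (col (lookup I (which p))) (cornerTriple (outerColor S) p)
  cubeEdge p with sameVariety-cornerTriple (proj₂ (lookup I (which p))) (unit-variety p) p
  ... | k , eq = k , trans eq (cornerTriple-local (col (unit S p)) (outerColor S) p (monochrome S p))

module _ (I : Instance) (v : Cube) (M : Matching I v 8) where
  open Matching M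

  private
    corner : Fin 8 → Corner
    corner j = proj₁ (proj₁ (isEdge j))

    corner-triple : ∀ j → cornerTriple (col v) (corner j) ≡ tripleNode j
    corner-triple j = proj₂ (proj₁ (isEdge j))

    corner-injective : Injective _≡_ _≡_ corner
    corner-injective {i} {j} eq = tripleDisj (begin
      tripleNode i                     ≡⟨ corner-triple i ⟨
      cornerTriple (col v) (corner i)  ≡⟨ cong (cornerTriple (col v)) eq ⟩
      cornerTriple (col v) (corner j)  ≡⟨ corner-triple j ⟩
      tripleNode j                     ∎)

    matchedAt : Position → Fin 8
    matchedAt p = proj₁ (corner-injective⇒surjective corner corner-injective p)

    corner-matchedAt : ∀ p → corner (matchedAt p) ≡ p
    corner-matchedAt p = proj₂ (corner-injective⇒surjective corner corner-injective p)

    which : Position → Fin (length I)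
    which p = cubeNode (matchedAt p)

    which-injective : Injective _≡_ _≡_ which
    which-injective {p} {q} eq =
      trans (sym (corner-matchedAt p)) (trans (cong corner (cubeDisj eq)) (corner-matchedAt q))

    cube : Position → Cube
    cube p = lookup I (which p)

    cubeCorner : Position → Corner
    cubeCorner p = proj₁ (proj₂ (isEdge (matchedAt p)))

    cubeCorner-triple : ∀ p → cornerTriple (col (cube p)) (cubeCorner p) ≡ cornerTriple (col v) p
    cubeCorner-triple p = begin
      cornerTriple (col (cube p)) (cubeCorner p)   ≡⟨ proj₂ (proj₂ (isEdge (matchedAt p))) ⟩
      tripleNode (matchedAt p)                     ≡⟨ corner-triple (matchedAt p) ⟨
      cornerTriple (col v) (corner (matchedAt p))  ≡⟨ cong (cornerTriple (col v)) (corner-matchedAt p) ⟩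
      cornerTriple (col v) p                       ∎

    aligned : ∀ p → ∃ λ R → AgreeAt (col (cube p) ∘ rotFace R) (col v) p
    aligned p = cornerTriple-align (col (cube p)) (col v) (cubeCorner p) p (cubeCorner-triple p)

    orientation : Position → Rotation
    orientation p = proj₁ (aligned p)

    solid : Solid
    solid = record
      { unit = λ p → rotateCube (orientation p) (cube p)
      ; outerColor = col v
      ; monochrome = λ p → proj₂ (aligned p)
      ; outerDistinct = proj₂ v }

  matching⇒composable : Composable I v
  matching⇒composable =
    solid , which , which-injective , (λ p → orientation p , λ _ → refl) , sameVariety-refl (col v)

proposition3 : (I : Instance) (v : Cube) → Composable I v ⇔ Matching I v 8
proposition3 I v = mk⇔ (composable⇒matching I v) (matching⇒composable I v)
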